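{- Let $n$ be a positive integer and let $h:\{0,1\}^n\to\{0,1\}$ be a (deterministic) function. Suppose there exist integers $D<R<n/2$ such that the set \[E_h^R=\{x\in\{0,1\}^n : h(x)\neq \mathrm{Maj}_n(x),\ |x|\notin(R,n-R)\}\] satisfies $|E_h^R|<\binom{n}{\leq R-D}$. Then $\deg(h)>D$.
   Context: $|x|$ denotes the Hamming weight of $x$. $\mathrm{Maj}_n:\{0,1\}^n\to\{0,1\}$ is the Majority function, accepting exactly the inputs of Hamming weight greater than $n/2$. $\binom{n}{\leq i}$ denotes $\sum_{j=0}^{i}\binom{n}{j}$. $\deg(h)$ is the degree of the (unique) multilinear polynomial over $\mathbb{F}_2$ representing $h$. -}

module Defs where

open import Data.Bool using (Bool; true; false; _∧_; _∨_; not; _xor_; if_then_else_)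
open import Data.Nat using (ℕ; zero; suc; _+_; _*_; _≤_; _<_; _≤ᵇ_; _<ᵇ_)
open import Data.Nat.Combinatorics using (_C_)
open import Data.Vec using (Vec; []; _∷_; count; zipWith; foldr)
open import Data.List as List using (List; []; _∷_; _++_; map; length; filter; foldr)
open import Relation.Binary.PropositionalEquality using (_≡_)
open import Data.Product using (Σ)
open import Data.Empty using (⊥)
open import Relation.Nullary using (¬_)

-- Points of {0,1}^n are Boolean vectors (true = 1).
-- A function {0,1}^n → {0,1}.
BoolFun : ℕ → Set
BoolFun n = Vec Bool n → Bool

allVecs : (n : ℕ) → List (Vec Bool n)
allVecs zero    = [] ∷ []
allVecs (suc n) = map (false ∷_) (allVecs n) ++ map (true ∷_) (allVecs n)

weight : ∀ {n} → Vec Bool n → ℕ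
weight []          = 0
weight (true ∷ x)  = suc (weight x)
weight (false ∷ x) = weight x

-- Maj_n(x) = 1 iff |x| > n/2, i.e. 2|x| > n.
Maj : (n : ℕ) → BoolFun n
Maj n x = n <ᵇ (weight x + weight x)

binomLE : ℕ → ℕ → ℕ
binomLE n zero    = n C 0
binomLE n (suc i) = binomLE n i + n C (suc i)

_≠ᵇ_ : Bool → Bool → Bool
a ≠ᵇ b = a xor b

-- Membership test for E_h^R: h(x) ≠ Maj_n(x) and |x| ∉ (R, n−R),
-- i.e. |x| ≤ R or |x| ≥ n − R (written |x| + R ≥ n to stay in ℕ).
inE : (n : ℕ) → BoolFun n → ℕ → Vec Bool n → Bool
inE n h R x = (h x ≠ᵇ Maj n x) ∧ ((weight x ≤ᵇ R) ∨ (n ≤ᵇ (weight x + R)))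

cardE : (n : ℕ) → BoolFun n → ℕ → ℕ
cardE n h R = length (filter (λ x → inE n h R x ≡? true) (allVecs n))
  where
  open import Data.Bool.Properties using () renaming (_≟_ to _≡?_)

-- Multilinear polynomials over F₂ in n variables: a coefficient c_S ∈ F₂ for
-- each monomial x_S = ∏_{i∈S} x_i, where S ⊆ [n] is given by its
-- characteristic vector.
MultilinPoly : ℕ → Set
MultilinPoly n = Vec Bool n → Bool

-- S ⊆ supp(x), i.e. the monomial x_S evaluates to 1 at x.
monomial : ∀ {n} → Vec Bool n → Vec Bool n → Bool
monomial []      []      = true
monomial (s ∷ S) (b ∷ x) = ((not s) ∨ b) ∧ monomial S x

evalPoly : ∀ {n} → MultilinPoly n → Vec Bool n → Bool
evalPoly {n} c x = List.foldr (λ S acc → (c S ∧ monomial S x) xor acc) false (allVecs n)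

PolyDegLE : ∀ {n} → MultilinPoly n → ℕ → Set
PolyDegLE c D = ∀ S → c S ≡ true → weight S ≤ D

Represents : ∀ {n} → MultilinPoly n → BoolFun n → Set
Represents p h = ∀ x → evalPoly p x ≡ h x

-- deg(h) ≤ D: the (unique) multilinear F₂-polynomial representing h has
-- degree ≤ D (existence of such a representation; by uniqueness equivalent).
DegLE : ∀ {n} → BoolFun n → ℕ → Set
DegLE {n} h D = Σ (MultilinPoly n) (λ p → Represents p h × PolyDegLE p D)
  where open import Data.Product using (_×_)

DegGT : ∀ {n} → BoolFun n → ℕ → Set
DegGT h D = ¬ DegLE h D

-- Suppose deg h ≤ D and put k = R − D.  Polynomials of degree ≤ k form
-- a space of dimension binom(n, ≤ k) > |E|, so (Gaussian elimination over F₂)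
-- some nonzero g of degree ≤ k vanishes on E.  The product g·h has
-- degree ≤ R and vanishes on the Hamming ball of radius R: on E since g does,
-- elsewhere since h = Maj = 0 there.  A polynomial of degree ≤ R vanishing on
-- that ball is zero, so g·h = 0.  Near the all-ones point (weight ≥ n − k)
-- g vanishes too: on E by choice, elsewhere since h = Maj = 1 and g·h = 0.
-- By the dual ball lemma g = 0, a contradiction.
module Submission where

open import Defs
open import Algebra.Bundles using (CommutativeRing; CommutativeMonoid)
open import Data.Bool using (Bool; true; false; _∧_; _∨_; _xor_; T)
open import Data.Bool.Properties
  using (_≟_; ∧-assoc; ∧-comm; ∧-identityʳ; ∧-zeroʳ; ∨-zeroʳ; ∧-distribˡ-xor; ∧-distribʳ-xor; xor-assoc; xor-comm;
         xor-identityʳ; xor-same; not-involutive; T-≡; xor-∧-commutativeRing; ∧-commutativeMonoid)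
open import Data.Empty using (⊥-elim)
open import Data.List as List using (List; []; _∷_; length; filter)
open import Data.List.Properties using (length-map; foldr-map)
open import Data.List.Membership.Propositional using (_∈_)
open import Data.List.Membership.Propositional.Properties using (∈-map⁺; ∈-++⁺ˡ; ∈-++⁺ʳ; ∈-filter⁺)
open import Data.List.Relation.Unary.All as All using (All; []; _∷_)
open import Data.List.Relation.Unary.All.Properties using (map⁻)
open import Data.List.Relation.Unary.Any using (here)
open import Data.List.Relation.Binary.Permutation.Propositional using (_↭_; ↭-refl; ↭-sym; ↭-trans; prep; swap)
open import Data.List.Relation.Binary.Permutation.Propositional.Properties using (All-resp-↭; ↭-length)
open import Data.Nat using (ℕ; zero; suc; _+_; _∸_; _<_; _≤_; _≤ᵇ_; s≤s; z<s; s<s; pred)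
open import Data.Nat.Properties
  using (+-suc; +-comm; +-identityʳ; +-mono-≤; +-monoˡ-≤; +-monoʳ-≤; +-monoʳ-<; ≤-trans; ≤-<-trans; ≤-pred;
         <-asym; <-irrefl; <⇒≤; ≰⇒>; pred-mono-≤; m∸n≤m; m∸n+n≡m; <ᵇ⇒<; <⇒<ᵇ; ≤⇒≤ᵇ)
open import Data.Nat.Combinatorics using (_C_; nCk+nC[k+1]≡[n+1]C[k+1])
open import Data.Product using (_×_; _,_; ∃; ∃₂)
open import Data.Sum using (_⊎_; inj₁; inj₂)
open import Data.Unit using (⊤; tt)
open import Data.Vec using (Vec; []; _∷_; _++_; replicate; zipWith; splitAt; tail)
import Data.Vec as Vec
open import Function using (_∘_)
open import Function.Bundles using (Equivalence)
open import Relation.Nullary using (¬_)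
open import Relation.Binary.PropositionalEquality
open ≡-Reasoning

open import Algebra.Properties.CommutativeSemigroup
  (CommutativeRing.+-commutativeSemigroup xor-∧-commutativeRing) using () renaming (interchange to xor-interchange)
open import Algebra.Properties.CommutativeSemigroup
  (CommutativeMonoid.commutativeSemigroup ∧-commutativeMonoid) using () renaming (x∙yz≈y∙xz to ∧-swapˡ)

xor-cancelˡ : ∀ a b → a xor (a xor b) ≡ b
xor-cancelˡ false b = refl
xor-cancelˡ true  b = not-involutive b

xor-cancelʳ : ∀ a b → b xor (a xor b) ≡ a
xor-cancelʳ a b = trans (cong (b xor_) (xor-comm a b)) (xor-cancelˡ b a)

xor≡false⇒≡ : ∀ a b → a xor b ≡ false → a ≡ b
xor≡false⇒≡ false false _ = refl
xor≡false⇒≡ true  true  _ = refl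
xor≡false⇒≡ false true  ()
xor≡false⇒≡ true  false ()

-- The product rule for the derivative: with f = (a, b) and g = (c, e) on the
-- two halves, ∂(fg) = ∂f · g(1,·) ⊕ f(0,·) · ∂g.
product-rule : ∀ a b c e → (a ∧ c) xor (b ∧ e) ≡ ((a xor b) ∧ e) xor (a ∧ (c xor e))
product-rule false b     c e = sym (xor-identityʳ (b ∧ e))
product-rule true  true  c e = refl
product-rule true  false c e = trans (xor-identityʳ c) (sym (xor-cancelʳ c e))

false-unless-T : ∀ {b} → ¬ T b → b ≡ false
false-unless-T {false} _  = refl
false-unless-T {true}  ¬t = ⊥-elim (¬t tt)

-- Degree of Boolean functions, through the derivative in the first variable.

Fun : ℕ → Set
Fun n = Vec Bool n → Bool

Zero : ∀ {n} → Fun n → Set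
Zero f = ∀ x → f x ≡ false

at₀ at₁ ∂ : ∀ {n} → Fun (suc n) → Fun n
at₀ f x = f (false ∷ x)
at₁ f x = f (true ∷ x)
∂ f x = at₀ f x xor at₁ f x

at₁-via-∂ : ∀ {n} (f : Fun (suc n)) x → at₁ f x ≡ at₀ f x xor ∂ f x
at₁-via-∂ f x = sym (xor-cancelˡ (at₀ f x) (at₁ f x))

at₀-via-∂ : ∀ {n} (f : Fun (suc n)) x → at₀ f x ≡ at₁ f x xor ∂ f x
at₀-via-∂ f x = sym (xor-cancelʳ (at₀ f x) (at₁ f x))

zero-from-at₀ : ∀ {n} {f : Fun (suc n)} → Zero (at₀ f) → Zero (∂ f) → Zero f
zero-from-at₀         z₀ z∂ (false ∷ x) = z₀ x
zero-from-at₀ {f = f} z₀ z∂ (true ∷ x)  = trans (at₁-via-∂ f x) (cong₂ _xor_ (z₀ x) (z∂ x))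

zero-from-at₁ : ∀ {n} {f : Fun (suc n)} → Zero (at₁ f) → Zero (∂ f) → Zero f
zero-from-at₁ {f = f} z₁ z∂ (false ∷ x) = trans (at₀-via-∂ f x) (cong₂ _xor_ (z₁ x) (z∂ x))
zero-from-at₁         z₁ z∂ (true ∷ x)  = z₁ x

-- DegLT n d f: f has F₂-degree < d.  Writing f(b, x) = f(0,x) ⊕ b·∂f(x),
-- this holds iff f(0,·) has degree < d and ∂f has degree < d − 1.
DegLT : ∀ n → ℕ → Fun n → Set
DegLT zero    zero    f = f [] ≡ false
DegLT zero    (suc d) f = ⊤
DegLT (suc n) d       f = DegLT n d (at₀ f) × DegLT n (pred d) (∂ f)

degLT-resp : ∀ n d {f g : Fun n} → f ≗ g → DegLT n d f → DegLT n d g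
degLT-resp zero    zero    f≗g p         = trans (sym (f≗g [])) p
degLT-resp zero    (suc d) _   _         = tt
degLT-resp (suc n) d       f≗g (p₀ , p∂) =
  degLT-resp n d (f≗g ∘ (false ∷_)) p₀ ,
  degLT-resp n (pred d) (λ x → cong₂ _xor_ (f≗g (false ∷ x)) (f≗g (true ∷ x))) p∂

degLT-zero : ∀ n d {f : Fun n} → Zero f → DegLT n d f
degLT-zero zero    zero    z = z []
degLT-zero zero    (suc d) z = tt
degLT-zero (suc n) d       z =
  degLT-zero n d (z ∘ (false ∷_)) ,
  degLT-zero n (pred d) (λ x → cong₂ _xor_ (z (false ∷ x)) (z (true ∷ x)))

degLT-xor : ∀ n d {f g : Fun n} → DegLT n d f → DegLT n d g → DegLT n d (λ x → f x xor g x)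
degLT-xor zero    zero    p q = cong₂ _xor_ p q
degLT-xor zero    (suc d) _ _ = tt
degLT-xor (suc n) d {f} {g} (p₀ , p∂) (q₀ , q∂) =
  degLT-xor n d p₀ q₀ ,
  degLT-resp n (pred d) (λ x → xor-interchange (at₀ f x) (at₁ f x) (at₀ g x) (at₁ g x))
    (degLT-xor n (pred d) p∂ q∂)

degLT-suc  : ∀ n d {f : Fun n} → DegLT n d f → DegLT n (suc d) f
degLT-pred : ∀ n d {f : Fun n} → DegLT n (pred d) f → DegLT n d f
degLT-suc zero    zero    _         = tt
degLT-suc zero    (suc d) _         = tt
degLT-suc (suc n) d       (p₀ , p∂) = degLT-suc n d p₀ , degLT-pred n d p∂
degLT-pred n zero    p = p
degLT-pred n (suc d) p = degLT-suc n d p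

degLT-at₁ : ∀ n d {f : Fun (suc n)} → DegLT (suc n) d f → DegLT n d (at₁ f)
degLT-at₁ n d {f} (p₀ , p∂) =
  degLT-resp n d (λ x → sym (at₁-via-∂ f x)) (degLT-xor n d p₀ (degLT-pred n d p∂))

<-pred⇒suc< : ∀ {m} d → m < pred d → suc m < d
<-pred⇒suc< (suc d) m<d = s<s m<d

-- Ball lemma: degree < d and zero on all points of weight < d forces f = 0.
-- (Induction: f(0,·) is zero on its ball, and ∂f on the ball of radius d − 1.)
degLT-low : ∀ n d {f : Fun n} → DegLT n d f → (∀ x → weight x < d → f x ≡ false) → Zero f
degLT-low zero    zero    p _     [] = p
degLT-low zero    (suc d) _ small [] = small [] z<s
degLT-low (suc n) d {f} (p₀ , p∂) small = zero-from-at₀ z₀ (degLT-low n (pred d) p∂ small∂)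
  where
  z₀ : Zero (at₀ f)
  z₀ = degLT-low n d p₀ (λ x → small (false ∷ x))
  small∂ : ∀ x → weight x < pred d → ∂ f x ≡ false
  small∂ x w = cong₂ _xor_ (z₀ x) (small (true ∷ x) (<-pred⇒suc< d w))

degLT0⇒zero : ∀ n {f : Fun n} → DegLT n 0 f → Zero f
degLT0⇒zero n p = degLT-low n 0 p (λ _ ())

-- Degrees add under multiplication: deg f < a + 1, deg g < b + 1 ⇒ deg fg < a + b + 1.
-- The auxiliary form also allows the degenerate bound a = 0, i.e. f = 0.
degLT-∧  : ∀ n a b {f g : Fun n} → DegLT n (suc a) f → DegLT n (suc b) g →
           DegLT n (suc (a + b)) (λ x → f x ∧ g x)
degLT-∧′ : ∀ n a b {f g : Fun n} → DegLT n a f → DegLT n (suc b) g → DegLT n (a + b) (λ x → f x ∧ g x)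

degLT-∧ zero    a b _ _ = tt
degLT-∧ (suc n) a b {f} {g} (p₀ , p∂) q@(q₀ , q∂) =
  degLT-∧ n a b p₀ q₀ ,
  degLT-resp n (a + b) (λ x → sym (product-rule (at₀ f x) (at₁ f x) (at₀ g x) (at₁ g x)))
    (degLT-xor n (a + b) (degLT-∧′ n a b {∂ f} {at₁ g} p∂ (degLT-at₁ n (suc b) {g} q)) f₀∂g)
  where
  f₀∂g : DegLT n (a + b) (λ x → at₀ f x ∧ ∂ g x)
  f₀∂g = subst (λ d → DegLT n d (λ x → at₀ f x ∧ ∂ g x)) (+-comm b a)
           (degLT-resp n (b + a) (λ x → ∧-comm (∂ g x) (at₀ f x)) (degLT-∧′ n b a {∂ g} {at₀ f} q∂ p₀))

degLT-∧′ n zero    b {f} {g} p _ =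
  degLT-zero n b (λ x → cong (_∧ g x) (degLT0⇒zero n p x))
degLT-∧′ n (suc a) b p q = degLT-∧ n a b p q

-- The same around the all-ones point: zero on all x with n − |x| < d forces f = 0.
-- (Induction: f(1,·) is zero on its ball, and then ∂f on the ball of radius d − 1.)
degLT-high : ∀ n d {f : Fun n} → DegLT n d f → (∀ x → n < weight x + d → f x ≡ false) → Zero f
degLT-high n       zero    p _     = degLT0⇒zero n p
degLT-high zero    (suc d) _ large [] = large [] z<s
degLT-high (suc n) (suc d) {f} p@(_ , p∂) large = zero-from-at₁ z₁ (degLT-high n d p∂ large∂)
  where
  z₁ : Zero (at₁ f)
  z₁ = degLT-high n (suc d) (degLT-at₁ n (suc d) {f} p) (λ x w → large (true ∷ x) (s<s w))
  large∂ : ∀ x → n < weight x + d → ∂ f x ≡ false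
  large∂ x w =
    cong₂ _xor_ (large (false ∷ x) (subst (suc n <_) (sym (+-suc (weight x) d)) (s<s w))) (z₁ x)

record Expansion {n} (f : Fun (suc n)) (u v : Fun n) : Set where
  constructor expansion
  field expand : ∀ b x → f (b ∷ x) ≡ u x xor (b ∧ v x)

module _ {n} {f : Fun (suc n)} {u v : Fun n} (e : Expansion f u v) where

  open Expansion e

  expansion-at₀ : at₀ f ≗ u
  expansion-at₀ x = trans (expand false x) (xor-identityʳ (u x))

  expansion-∂ : ∂ f ≗ v
  expansion-∂ x = begin
    ∂ f x                  ≡⟨ cong₂ _xor_ (expansion-at₀ x) (expand true x) ⟩
    u x xor (u x xor v x)  ≡⟨ xor-cancelˡ (u x) (v x) ⟩
    v x                    ∎

  degLT-expansion : ∀ d → DegLT n d u → DegLT n (pred d) v → DegLT (suc n) d f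
  degLT-expansion d p q =
    degLT-resp n d (λ x → sym (expansion-at₀ x)) p ,
    degLT-resp n (pred d) (λ x → sym (expansion-∂ x)) q

  zero-expansion : Zero f → Zero u × Zero v
  zero-expansion z =
    (λ x → trans (sym (expansion-at₀ x)) (z (false ∷ x))) ,
    (λ x → trans (sym (expansion-∂ x)) (cong₂ _xor_ (z (false ∷ x)) (z (true ∷ x))))

⊕-sum : ∀ {A : Set} → (A → Bool) → List A → Bool
⊕-sum f = List.foldr (λ a acc → f a xor acc) false

⊕-sum-++ : ∀ {A : Set} (f : A → Bool) l₁ l₂ → ⊕-sum f (l₁ List.++ l₂) ≡ ⊕-sum f l₁ xor ⊕-sum f l₂
⊕-sum-++ f []       l₂ = refl
⊕-sum-++ f (a ∷ l₁) l₂ = trans (cong (f a xor_) (⊕-sum-++ f l₁ l₂)) (sym (xor-assoc (f a) _ _))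

⊕-sum-map : ∀ {A B : Set} (f : B → Bool) (g : A → B) l → ⊕-sum f (List.map g l) ≡ ⊕-sum (f ∘ g) l
⊕-sum-map f g = foldr-map _ g false

⊕-sum-cong : ∀ {A : Set} {f g : A → Bool} → f ≗ g → ∀ l → ⊕-sum f l ≡ ⊕-sum g l
⊕-sum-cong f≗g []      = refl
⊕-sum-cong f≗g (a ∷ l) = cong₂ _xor_ (f≗g a) (⊕-sum-cong f≗g l)

⊕-sum-scale : ∀ {A : Set} b (f : A → Bool) l → ⊕-sum (λ a → b ∧ f a) l ≡ b ∧ ⊕-sum f l
⊕-sum-scale b f []      = sym (∧-zeroʳ b)
⊕-sum-scale b f (a ∷ l) =
  trans (cong ((b ∧ f a) xor_) (⊕-sum-scale b f l)) (sym (∧-distribˡ-xor b (f a) _))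

-- Splitting the monomials by whether they contain x₁ expands evalPoly.
evalPoly-split : ∀ {n} (c : MultilinPoly (suc n)) b x →
  evalPoly c (b ∷ x) ≡ evalPoly (at₀ c) x xor (b ∧ evalPoly (at₁ c) x)
evalPoly-split {n} c b x = begin
  ⊕-sum term (List.map (false ∷_) V List.++ List.map (true ∷_) V)
    ≡⟨ ⊕-sum-++ term (List.map (false ∷_) V) (List.map (true ∷_) V) ⟩
  ⊕-sum term (List.map (false ∷_) V) xor ⊕-sum term (List.map (true ∷_) V)
    ≡⟨ cong₂ _xor_ (⊕-sum-map term (false ∷_) V) (⊕-sum-map term (true ∷_) V) ⟩
  evalPoly (at₀ c) x xor ⊕-sum (λ S → at₁ c S ∧ (b ∧ monomial S x)) V
    ≡⟨ cong (evalPoly (at₀ c) x xor_) (⊕-sum-cong (λ S → ∧-swapˡ (at₁ c S) b (monomial S x)) V) ⟩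
  evalPoly (at₀ c) x xor ⊕-sum (λ S → b ∧ (at₁ c S ∧ monomial S x)) V
    ≡⟨ cong (evalPoly (at₀ c) x xor_) (⊕-sum-scale b (λ S → at₁ c S ∧ monomial S x) V) ⟩
  evalPoly (at₀ c) x xor (b ∧ evalPoly (at₁ c) x) ∎
  where
  V = allVecs n
  term : Vec Bool (suc n) → Bool
  term S = c S ∧ monomial S (b ∷ x)

polyDegLT : ∀ n d (c : MultilinPoly n) → (∀ S → c S ≡ true → weight S < d) → DegLT n d (evalPoly c)
polyDegLT zero    zero    c small with c [] in eq
... | false = refl
... | true  = ⊥-elim (<-irrefl refl (small [] eq))
polyDegLT zero    (suc d) c _     = tt
polyDegLT (suc n) d       c small =
  degLT-expansion {f = evalPoly c} (expansion (evalPoly-split c)) d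
    (polyDegLT n d (at₀ c) (λ S → small (false ∷ S)))
    (polyDegLT n (pred d) (at₁ c) (λ S e → pred-mono-≤ (small (true ∷ S) e)))

degLE⇒degLT : ∀ {n} (h : BoolFun n) D → DegLE h D → DegLT n (suc D) h
degLE⇒degLT {n} h D (p , p≈h , deg-p) = degLT-resp n (suc D) p≈h (polyDegLT n (suc D) p (λ S e → s≤s (deg-p S e)))

dot : ∀ {N} → Vec Bool N → Vec Bool N → Bool
dot []      []      = false
dot (a ∷ r) (b ∷ c) = (a ∧ b) xor dot r c

Orthogonal : ∀ {N} → Vec Bool N → List (Vec Bool N) → Set
Orthogonal c rows = All (λ r → dot r c ≡ false) rows

dot-zeroʳ : ∀ {N} (r : Vec Bool N) → dot r (replicate N false) ≡ false
dot-zeroʳ []      = refl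
dot-zeroʳ (a ∷ r) = trans (cong (_xor dot r _) (∧-zeroʳ a)) (dot-zeroʳ r)

dot-xorˡ : ∀ {N} (u t y : Vec Bool N) → dot (zipWith _xor_ u t) y ≡ dot u y xor dot t y
dot-xorˡ []      []      []      = refl
dot-xorˡ (a ∷ u) (b ∷ t) (c ∷ y) = begin
  ((a xor b) ∧ c) xor dot (zipWith _xor_ u t) y
    ≡⟨ cong₂ _xor_ (∧-distribʳ-xor c a b) (dot-xorˡ u t y) ⟩
  ((a ∧ c) xor (b ∧ c)) xor (dot u y xor dot t y)
    ≡⟨ xor-interchange (a ∧ c) (b ∧ c) (dot u y) (dot t y) ⟩
  ((a ∧ c) xor dot u y) xor ((b ∧ c) xor dot t y) ∎

-- Elimination with the pivot row (1, t): a row starting with 1 has the pivot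
-- added to it.  For y and the extension (t·y, y) the dot products agree.
eliminate : ∀ {N} → Vec Bool N → Vec Bool (suc N) → Vec Bool N
eliminate t (false ∷ u) = u
eliminate t (true ∷ u)  = zipWith _xor_ u t

dot-eliminate : ∀ {N} (t y : Vec Bool N) r → dot (eliminate t r) y ≡ dot r (dot t y ∷ y)
dot-eliminate t y (false ∷ u) = refl
dot-eliminate t y (true ∷ u)  = trans (dot-xorˡ u t y) (xor-comm (dot u y) (dot t y))

pivot : ∀ {N} (rows : List (Vec Bool (suc N))) →
  All (λ r → Vec.head r ≡ false) rows ⊎ ∃₂ λ t rest → rows ↭ (true ∷ t) ∷ rest
pivot []                 = inj₁ []
pivot ((true ∷ t) ∷ rs)  = inj₂ (t , rs , ↭-refl)
pivot ((false ∷ u) ∷ rs) with pivot rs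
... | inj₁ heads         = inj₁ (refl ∷ heads)
... | inj₂ (t , rest , π) = inj₂ (t , (false ∷ u) ∷ rest , ↭-trans (prep _ π) (swap _ _ ↭-refl))

dot-first-unit : ∀ {N} (r : Vec Bool (suc N)) → Vec.head r ≡ false → dot r (true ∷ replicate N false) ≡ false
dot-first-unit (false ∷ u) refl = dot-zeroʳ u

-- Fewer than N homogeneous equations in N unknowns over F₂ have a nonzero
-- solution: eliminate the first unknown with a pivot row and recurse.
nonzero-solution : ∀ N (rows : List (Vec Bool N)) → length rows < N →
  ∃ λ c → c ≢ replicate N false × Orthogonal c rows
nonzero-solution (suc N) rows few with pivot rows
... | inj₁ heads = true ∷ replicate N false , (λ ()) , All.map (λ {r} → dot-first-unit r) heads
... | inj₂ (t , rest , π) =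
  let (y , y≢0 , y⊥) = nonzero-solution N (List.map (eliminate t) rest) fewer
  in  dot t y ∷ y ,
      (λ eq → y≢0 (cong tail eq)) ,
      All-resp-↭ (↭-sym π)
        (xor-same (dot t y) ∷ All.map (λ {r} e → trans (sym (dot-eliminate t y r)) e) (map⁻ y⊥))
  where
  fewer : length (List.map (eliminate t) rest) < N
  fewer = subst (_< N) (sym (length-map (eliminate t) rest)) (≤-pred (subst (_< suc N) (↭-length π) few))

-- Polynomials of degree < d by their coefficient vectors.

monomialCount : ℕ → ℕ → ℕ
monomialCount zero    zero    = 0
monomialCount zero    (suc d) = 1
monomialCount (suc n) d       = monomialCount n d + monomialCount n (pred d)

-- The values at x of all monomials of degree < d: those without x₁, then
-- x₁ times those of degree < d − 1 in the remaining variables.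
monomials : ∀ {n} d → Vec Bool n → Vec Bool (monomialCount n d)
monomials {zero}  zero    []      = []
monomials {zero}  (suc d) []      = true ∷ []
monomials {suc n} d       (b ∷ x) = monomials d x ++ Vec.map (b ∧_) (monomials (pred d) x)

polyOf : ∀ n d → Vec Bool (monomialCount n d) → Fun n
polyOf n d c x = dot (monomials d x) c

dot-++ : ∀ {m N} (r₀ c₀ : Vec Bool m) (r₁ c₁ : Vec Bool N) → dot (r₀ ++ r₁) (c₀ ++ c₁) ≡ dot r₀ c₀ xor dot r₁ c₁
dot-++ []       []       r₁ c₁ = refl
dot-++ (a ∷ r₀) (b ∷ c₀) r₁ c₁ =
  trans (cong ((a ∧ b) xor_) (dot-++ r₀ c₀ r₁ c₁)) (sym (xor-assoc (a ∧ b) (dot r₀ c₀) (dot r₁ c₁)))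

dot-scale : ∀ {N} b (r c : Vec Bool N) → dot (Vec.map (b ∧_) r) c ≡ b ∧ dot r c
dot-scale b []      []      = sym (∧-zeroʳ b)
dot-scale b (a ∷ r) (e ∷ c) =
  trans (cong₂ _xor_ (∧-assoc b a e) (dot-scale b r c)) (sym (∧-distribˡ-xor b (a ∧ e) (dot r c)))

polyOf-expansion : ∀ n d (c₀ : Vec Bool (monomialCount n d)) (c₁ : Vec Bool (monomialCount n (pred d))) →
  Expansion (polyOf (suc n) d (c₀ ++ c₁)) (polyOf n d c₀) (polyOf n (pred d) c₁)
polyOf-expansion n d c₀ c₁ = expansion λ b x →
  trans (dot-++ (monomials d x) c₀ _ c₁) (cong (polyOf n d c₀ x xor_) (dot-scale b (monomials (pred d) x) c₁))

polyOf-degLT : ∀ n d (c : Vec Bool (monomialCount n d)) → DegLT n d (polyOf n d c)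
polyOf-degLT zero    zero    [] = refl
polyOf-degLT zero    (suc d) c  = tt
polyOf-degLT (suc n) d       c  with splitAt (monomialCount n d) c
... | c₀ , c₁ , refl =
  degLT-expansion (polyOf-expansion n d c₀ c₁) d (polyOf-degLT n d c₀) (polyOf-degLT n (pred d) c₁)

replicate-++ : ∀ m k → replicate m false ++ replicate k false ≡ replicate (m + k) false
replicate-++ zero    k = refl
replicate-++ (suc m) k = cong (false ∷_) (replicate-++ m k)

polyOf-zero : ∀ n d (c : Vec Bool (monomialCount n d)) → Zero (polyOf n d c) → c ≡ replicate _ false
polyOf-zero zero    zero    []      _ = refl
polyOf-zero zero    (suc d) (a ∷ []) z = cong (_∷ []) (trans (sym (xor-identityʳ a)) (z []))
polyOf-zero (suc n) d       c       z with splitAt (monomialCount n d) c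
... | c₀ , c₁ , refl =
  let (z₀ , z₁) = zero-expansion (polyOf-expansion n d c₀ c₁) z
  in  trans (cong₂ _++_ (polyOf-zero n d c₀ z₀) (polyOf-zero n (pred d) c₁ z₁))
            (replicate-++ (monomialCount n d) (monomialCount n (pred d)))

monomialCount-zero : ∀ n → monomialCount n 0 ≡ 0
monomialCount-zero zero    = refl
monomialCount-zero (suc n) = cong₂ _+_ (monomialCount-zero n) (monomialCount-zero n)

binomLE-zero : ∀ k → binomLE 0 k ≡ 1
binomLE-zero zero    = refl
binomLE-zero (suc k) = trans (+-identityʳ (binomLE 0 k)) (binomLE-zero k)

binomLE-pascal : ∀ n k → binomLE (suc n) (suc k) ≡ binomLE n (suc k) + binomLE n k
binomLE-pascal n zero    = trans (cong suc (sym (nCk+nC[k+1]≡[n+1]C[k+1] n 0))) (+-comm 1 (binomLE n 1))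
binomLE-pascal n (suc k) = begin
  binomLE (suc n) (suc k) + suc n C suc (suc k)
    ≡⟨ cong₂ _+_ (binomLE-pascal n k) (sym (nCk+nC[k+1]≡[n+1]C[k+1] n (suc k))) ⟩
  (binomLE n (suc k) + binomLE n k) + (n C suc k + n C suc (suc k))
    ≡⟨ regroup (binomLE n (suc k)) (binomLE n k) (n C suc k) (n C suc (suc k)) ⟩
  (binomLE n (suc k) + n C suc (suc k)) + (binomLE n k + n C suc k) ∎
  where
  open import Data.Nat.Tactic.RingSolver using (solve-∀)
  regroup : ∀ a b c e → (a + b) + (c + e) ≡ (a + e) + (b + c)
  regroup = solve-∀

monomialCount≡binomLE : ∀ n k → monomialCount n (suc k) ≡ binomLE n k
monomialCount≡binomLE zero    k       = sym (binomLE-zero k)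
monomialCount≡binomLE (suc n) zero    =
  trans (cong₂ _+_ (monomialCount≡binomLE n zero) (monomialCount-zero n)) (+-identityʳ (binomLE n 0))
monomialCount≡binomLE (suc n) (suc k) =
  trans (cong₂ _+_ (monomialCount≡binomLE n (suc k)) (monomialCount≡binomLE n k)) (sym (binomLE-pascal n k))

annihilator : ∀ n k (E : List (Vec Bool n)) → length E < binomLE n k →
  ∃ λ c → c ≢ replicate (monomialCount n (suc k)) false × All (λ x → polyOf n (suc k) c x ≡ false) E
annihilator n k E few =
  let (c , c≢0 , c⊥) = nonzero-solution (monomialCount n (suc k)) (List.map (monomials (suc k)) E) fewer
  in  c , c≢0 , map⁻ c⊥
  where
  fewer : length (List.map (monomials (suc k)) E) < monomialCount n (suc k)
  fewer = subst₂ _<_ (sym (length-map (monomials (suc k)) E)) (sym (monomialCount≡binomLE n k)) few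

allVecs-complete : ∀ {n} (x : Vec Bool n) → x ∈ allVecs n
allVecs-complete []            = here refl
allVecs-complete {suc n} (false ∷ x) = ∈-++⁺ˡ (∈-map⁺ (false ∷_) (allVecs-complete x))
allVecs-complete {suc n} (true ∷ x)  = ∈-++⁺ʳ (List.map (false ∷_) (allVecs n)) (∈-map⁺ (true ∷_) (allVecs-complete x))

pointsE : ∀ n → BoolFun n → ℕ → List (Vec Bool n)
pointsE n h R = filter (λ x → inE n h R x ≟ true) (allVecs n)

∈-pointsE : ∀ n h R x → inE n h R x ≡ true → x ∈ pointsE n h R
∈-pointsE n h R x = ∈-filter⁺ (λ x → inE n h R x ≟ true) (allVecs-complete x)

maj-low : ∀ {n R} (x : Vec Bool n) → R + R < n → weight x ≤ R → Maj n x ≡ false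
maj-low x 2R<n w≤R =
  false-unless-T (λ t → <-asym (<ᵇ⇒< _ _ t) (≤-<-trans (+-mono-≤ w≤R w≤R) 2R<n))

maj-high : ∀ {n R} (x : Vec Bool n) → R + R < n → n ≤ weight x + R → Maj n x ≡ true
maj-high {n} {R} x 2R<n n≤w+R = Equivalence.to T-≡ (<⇒<ᵇ (≤-<-trans n≤w+R (+-monoʳ-< (weight x) R<w)))
  where
  R<w : R < weight x
  R<w = ≰⇒> (λ w≤R → <-irrefl refl (≤-<-trans (≤-trans n≤w+R (+-monoˡ-≤ R w≤R)) 2R<n))

agrees-off-E : ∀ n (h : BoolFun n) R x → inE n h R x ≡ false →
  weight x ≤ R ⊎ n ≤ weight x + R → h x ≡ Maj n x
agrees-off-E n h R x off tail = xor≡false⇒≡ (h x) (Maj n x) (begin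
  h x xor Maj n x              ≡⟨ sym (∧-identityʳ _) ⟩
  (h x xor Maj n x) ∧ true     ≡⟨ cong ((h x xor Maj n x) ∧_) (sym (in-tail tail)) ⟩
  inE n h R x                  ≡⟨ off ⟩
  false                        ∎)
  where
  in-tail : weight x ≤ R ⊎ n ≤ weight x + R → (weight x ≤ᵇ R) ∨ (n ≤ᵇ weight x + R) ≡ true
  in-tail (inj₁ w≤R)   = cong (_∨ (n ≤ᵇ weight x + R)) (Equivalence.to T-≡ (≤⇒≤ᵇ w≤R))
  in-tail (inj₂ n≤w+R) =
    trans (cong ((weight x ≤ᵇ R) ∨_) (Equivalence.to T-≡ (≤⇒≤ᵇ n≤w+R))) (∨-zeroʳ (weight x ≤ᵇ R))

module _ {n} (h : BoolFun n) (R : ℕ) (2R<n : R + R < n) (g : Fun n)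
         (g-on-E : ∀ x → inE n h R x ≡ true → g x ≡ false) where

  -- Up to weight R, g·h vanishes: on E as g does, elsewhere as h = Maj = 0.
  product-vanishes-low : ∀ x → weight x ≤ R → g x ∧ h x ≡ false
  product-vanishes-low x w≤R with inE n h R x in eq
  ... | true  = cong (_∧ h x) (g-on-E x eq)
  ... | false = trans (cong (g x ∧_) h≡0) (∧-zeroʳ (g x))
    where
    h≡0 : h x ≡ false
    h≡0 = trans (agrees-off-E n h R x eq (inj₁ w≤R)) (maj-low x 2R<n w≤R)

  -- From weight n − R on, g vanishes once g·h does: h = Maj = 1 off E.
  factor-vanishes-high : Zero (λ x → g x ∧ h x) → ∀ x → n ≤ weight x + R → g x ≡ false
  factor-vanishes-high gh≡0 x n≤w+R with inE n h R x in eq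
  ... | true  = g-on-E x eq
  ... | false = trans (sym (∧-identityʳ (g x))) (trans (cong (g x ∧_) (sym h≡1)) (gh≡0 x))
    where
    h≡1 : h x ≡ true
    h≡1 = trans (agrees-off-E n h R x eq (inj₂ n≤w+R)) (maj-high x 2R<n n≤w+R)

lemma7p7 : (n : ℕ) → 0 < n → (h : BoolFun n) → (D R : ℕ) →
    D < R → R + R < n → cardE n h R < binomLE n (R ∸ D) → DegGT h D
lemma7p7 n _ h D R D<R 2R<n few deg-h≤D with annihilator n (R ∸ D) (pointsE n h R) few
... | c , c≢0 , c-on-E = c≢0 (polyOf-zero n (suc k) c g≡0)
  where
  k = R ∸ D
  g = polyOf n (suc k) c
  g-on-E : ∀ x → inE n h R x ≡ true → g x ≡ false
  g-on-E x x∈E = All.lookup c-on-E (∈-pointsE n h R x x∈E)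
  deg-gh : DegLT n (suc R) (λ x → g x ∧ h x)
  deg-gh = subst (λ d → DegLT n (suc d) (λ x → g x ∧ h x)) (m∸n+n≡m (<⇒≤ D<R))
             (degLT-∧ n k D (polyOf-degLT n (suc k) c) (degLE⇒degLT h D deg-h≤D))
  gh≡0 : Zero (λ x → g x ∧ h x)
  gh≡0 = degLT-low n (suc R) deg-gh (λ x w → product-vanishes-low h R 2R<n g g-on-E x (≤-pred w))
  upper-tail : ∀ x → n < weight x + suc k → n ≤ weight x + R
  upper-tail x w = ≤-trans (≤-pred (subst (n <_) (+-suc (weight x) k) w)) (+-monoʳ-≤ (weight x) (m∸n≤m R D))
  g≡0 : Zero g
  g≡0 = degLT-high n (suc k) (polyOf-degLT n (suc k) c)
          (λ x w → factor-vanishes-high h R 2R<n g g-on-E gh≡0 x (upper-tail x w))
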